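{- The non-negative integer solutions $(n,m,k)$ with $n \geq m$ of the Diophantine equation \[ J_n + J_m = L_k \] are exactly \[ (1,1,0),\ (2,1,0),\ (2,2,0),\ (1,0,1),\ (2,0,1),\ (3,0,2),\ (3,1,3),\ (3,2,3),\ (5,0,5). \]
   Context: $(L_k)_{k\geq 0}$ is the Lucas sequence: $L_0=2$, $L_1=1$, $L_{k+2}=L_{k+1}+L_k$ for all $k\geq 0$. $(J_n)_{n\geq 0}$ is the Jacobsthal sequence: $J_0=0$, $J_1=1$, $J_{n+2}=J_{n+1}+2J_n$ for all $n\geq 0$. -}

module Defs where

open import Data.Nat using (ℕ; zero; suc; _+_; _*_)
open import Data.Product using (_×_; _,_)
open import Data.List using (List; []; _∷_)

L : ℕ → ℕ
L zero = 2
L (suc zero) = 1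
L (suc (suc k)) = L (suc k) + L k

J : ℕ → ℕ
J zero = 0
J (suc zero) = 1
J (suc (suc n)) = J (suc n) + 2 * J n

solutions : List (ℕ × ℕ × ℕ)
solutions = (1 , 1 , 0) ∷ (2 , 1 , 0) ∷ (2 , 2 , 0) ∷ (1 , 0 , 1) ∷ (2 , 0 , 1)
          ∷ (3 , 0 , 2) ∷ (3 , 1 , 3) ∷ (3 , 2 , 3) ∷ (5 , 0 , 5) ∷ []

-- For n ≥ 6 the residues of J n modulo 80 repeat with period 4, and every sum J n + J m with
-- m ≥ 1 avoids the even residues 2, 4, 18, 76 of the Lucas numbers modulo 80. The case m = 0,
-- i.e. J n = L k, is excluded modulo 69184 = 2⁶ · 23 · 47: there J n is periodic from n = 6 on
-- with period 506 = lcm(2 · 11, 2 · 23) (2 has order 11 modulo 23 and 23 modulo 47), L has period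
-- 96, and no residue is shared. Periodicity is checked on pairs of consecutive residues, which
-- determine the rest of a second-order recurrence. For n ≤ 5 we have k ≤ L k ≤ 22, a finite search.
module Submission where

open import Defs
open import Data.Nat using (ℕ; _+_; _≤_)
open import Data.Product using (_×_; _,_)
open import Data.List.Membership.Propositional using (_∈_)
open import Relation.Binary.PropositionalEquality using (_≡_)
open import Function.Bundles using (_⇔_)

open import Data.Nat using (zero; suc; _*_; _/_; _<_; _%_; NonZero; s≤s; z≤n; _≟_; _<?_)
open import Data.Nat.Properties
  using (+-identityʳ; +-suc; +-comm; *-identityˡ; ≤-trans; +-mono-≤; m≤m+n; ≮⇒≥; m≤n⇒∃[o]m+o≡n; allUpTo?)
open import Data.Nat.DivMod using (%-distribˡ-+; %-distribˡ-*; m%n%n≡m%n; m%n<n; m≡m%n+[m/n]*n; %-congˡ)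
open import Data.Product using (proj₁)
open import Data.Product.Properties using (≡-dec)
open import Data.List using (List; []; _∷_; _++_; map; upTo)
import Data.List as List using (iterate)
open import Data.Nat.GeneralisedArithmetic using (iterate)
open import Data.List.Relation.Unary.All using (All; []; _∷_; all?; lookup)
open import Data.List.Relation.Unary.Any using (here; there)
open import Data.List.Membership.Propositional using (_∉_)
open import Data.List.Membership.Propositional.Properties using (∈-map⁺; ∈-upTo⁺; ∈-++⁺ˡ; ∈-++⁺ʳ)
open import Data.List.Membership.DecPropositional _≟_ using (_∈?_)
open import Relation.Binary.PropositionalEquality
  using (_≢_; refl; sym; trans; cong; cong₂; subst; module ≡-Reasoning)
open import Relation.Nullary using (Dec; yes; no; ¬?; contradiction)
open import Relation.Nullary.Decidable using (from-yes; _→-dec_)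
open import Function.Base using (_∘_)
open import Function.Bundles using (mk⇔)

iterate-+ : {A : Set} (f : A → A) (x : A) (m n : ℕ) →
            iterate f x (m + n) ≡ iterate f (iterate f x m) n
iterate-+ f x zero    n = refl
iterate-+ f x (suc m) n = iterate-+ f (f x) m n

iterate-periodic : {A : Set} (f : A → A) {x : A} {p : ℕ} → iterate f x p ≡ x →
                   ∀ q → iterate f x (q * p) ≡ x
iterate-periodic f         fix zero    = refl
iterate-periodic f {x} {p} fix (suc q) = begin
  iterate f x (p + q * p)           ≡⟨ iterate-+ f x p (q * p) ⟩
  iterate f (iterate f x p) (q * p) ≡⟨ cong (λ y → iterate f y (q * p)) fix ⟩
  iterate f x (q * p)               ≡⟨ iterate-periodic f fix q ⟩
  x                                 ∎
  where open ≡-Reasoning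

∈-iterate⁺ : {A : Set} (f : A → A) {x : A} {i p : ℕ} → i < p → iterate f x i ∈ List.iterate f x p
∈-iterate⁺ f {i = zero}  (s≤s _)   = here refl
∈-iterate⁺ f {i = suc i} (s≤s i<p) = there (∈-iterate⁺ f i<p)

∈-iterate-periodic⁺ : {A : Set} (f : A → A) {x : A} {p : ℕ} .{{_ : NonZero p}} →
                      iterate f x p ≡ x → ∀ n → iterate f x n ∈ List.iterate f x p
∈-iterate-periodic⁺ f {x} {p} fix n =
  subst (_∈ List.iterate f x p) (sym reduce) (∈-iterate⁺ f (m%n<n n p))
  where
  open ≡-Reasoning
  reduce : iterate f x n ≡ iterate f x (n % p)
  reduce = begin
    iterate f x n                                ≡⟨ cong (iterate f x) (trans (m≡m%n+[m/n]*n n p) (+-comm (n % p) _)) ⟩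
    iterate f x ((n / p) * p + n % p)            ≡⟨ iterate-+ f x ((n / p) * p) (n % p) ⟩
    iterate f (iterate f x ((n / p) * p)) (n % p) ≡⟨ cong (λ y → iterate f y (n % p)) (iterate-periodic f fix (n / p)) ⟩
    iterate f x (n % p)                          ∎

*-%-absorbʳ : ∀ a x M .{{_ : NonZero M}} → (a * (x % M)) % M ≡ (a * x) % M
*-%-absorbʳ a x M = begin
  (a * (x % M)) % M            ≡⟨ %-distribˡ-* a (x % M) M ⟩
  (a % M * (x % M % M)) % M    ≡⟨ cong (λ y → (a % M * y) % M) (m%n%n≡m%n x M) ⟩
  (a % M * (x % M)) % M        ≡⟨ sym (%-distribˡ-* a x M) ⟩
  (a * x) % M                  ∎
  where open ≡-Reasoning

Recurrent : ℕ → ℕ → (ℕ → ℕ) → Set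
Recurrent a b u = ∀ n → u (suc (suc n)) ≡ a * u (suc n) + b * u n

module Recurrence (a b M : ℕ) .{{_ : NonZero M}} where

  step : ℕ × ℕ → ℕ × ℕ
  step (x , y) = y , (a * y + b * x) % M

  state : (ℕ → ℕ) → ℕ → ℕ × ℕ
  state u n = u n % M , u (suc n) % M

  state-suc : ∀ {u} → Recurrent a b u → ∀ n → state u (suc n) ≡ step (state u n)
  state-suc {u} u-rec n = cong (u (suc n) % M ,_) (begin
    u (2 + n) % M                             ≡⟨ %-congˡ (u-rec n) ⟩
    (a * u (1 + n) + b * u n) % M             ≡⟨ %-distribˡ-+ (a * u (1 + n)) (b * u n) M ⟩
    ((a * u (1 + n)) % M + (b * u n) % M) % M
      ≡⟨ sym (cong₂ (λ y z → (y + z) % M) (*-%-absorbʳ a (u (1 + n)) M) (*-%-absorbʳ b (u n) M)) ⟩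
    ((a * (u (1 + n) % M)) % M + (b * (u n % M)) % M) % M
      ≡⟨ sym (%-distribˡ-+ (a * (u (1 + n) % M)) (b * (u n % M)) M) ⟩
    (a * (u (1 + n) % M) + b * (u n % M)) % M ∎)
    where open ≡-Reasoning

  state-+ : ∀ {u} → Recurrent a b u → ∀ n₀ n → state u (n₀ + n) ≡ iterate step (state u n₀) n
  state-+ {u} u-rec n₀ zero    = cong (state u) (+-identityʳ n₀)
  state-+ {u} u-rec n₀ (suc n) = begin
    state u (n₀ + suc n)                   ≡⟨ cong (state u) (+-suc n₀ n) ⟩
    state u (suc n₀ + n)                   ≡⟨ state-+ u-rec (suc n₀) n ⟩
    iterate step (state u (suc n₀)) n      ≡⟨ cong (λ s → iterate step s n) (state-suc u-rec n₀) ⟩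
    iterate step (step (state u n₀)) n     ∎
    where open ≡-Reasoning

  residues : ℕ × ℕ → ℕ → List ℕ
  residues s p = map proj₁ (List.iterate step s p)

  ∈-residues : ∀ u → Recurrent a b u → ∀ n₀ p .{{_ : NonZero p}} →
               iterate step (state u n₀) p ≡ state u n₀ →
               ∀ n → u (n₀ + n) % M ∈ residues (state u n₀) p
  ∈-residues u u-rec n₀ p fix n = subst (λ s → proj₁ s ∈ _) (sym (state-+ u-rec n₀ n))
                                    (∈-map⁺ proj₁ (∈-iterate-periodic⁺ step fix n))

  prefix : (ℕ → ℕ) → ℕ → List ℕ
  prefix u n₀ = map (λ i → u i % M) (upTo n₀)

  ∈-prefix++residues : ∀ u → Recurrent a b u → ∀ n₀ p .{{_ : NonZero p}} →
                       iterate step (state u n₀) p ≡ state u n₀ →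
                       ∀ n → u n % M ∈ prefix u n₀ ++ residues (state u n₀) p
  ∈-prefix++residues u u-rec n₀ p fix n with n <? n₀
  ... | yes n<n₀ = ∈-++⁺ˡ (∈-map⁺ (λ i → u i % M) (∈-upTo⁺ n<n₀))
  ... | no n≮n₀ with m≤n⇒∃[o]m+o≡n (≮⇒≥ n≮n₀)
  ...   | o , refl = ∈-++⁺ʳ (prefix u n₀) (∈-residues u u-rec n₀ p fix o)

SumsAvoid : (M : ℕ) .{{_ : NonZero M}} → List ℕ → List ℕ → List ℕ → Set
SumsAvoid M Xs Ys Zs = All (λ x → All (λ y → (x + y) % M ∉ Zs) Ys) Xs

sumsAvoid? : (M : ℕ) .{{_ : NonZero M}} (Xs Ys Zs : List ℕ) → Dec (SumsAvoid M Xs Ys Zs)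
sumsAvoid? M Xs Ys Zs = all? (λ x → all? (λ y → ¬? ((x + y) % M ∈? Zs)) Ys) Xs

sumsAvoid⇒+≢ : ∀ M .{{_ : NonZero M}} {Xs Ys Zs} → SumsAvoid M Xs Ys Zs →
               ∀ {x y z} → x % M ∈ Xs → y % M ∈ Ys → z % M ∈ Zs → x + y ≢ z
sumsAvoid⇒+≢ M {Zs = Zs} avoid {x} {y} {z} x∈ y∈ z∈ x+y≡z =
  lookup (lookup avoid x∈) y∈ (subst (_∈ Zs) residue-of-sum z∈)
  where
  residue-of-sum : z % M ≡ (x % M + y % M) % M
  residue-of-sum = trans (%-congˡ (sym x+y≡z)) (%-distribˡ-+ x y M)

J-recurrent : Recurrent 1 2 J
J-recurrent n = cong (_+ 2 * J n) (sym (*-identityˡ (J (suc n))))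

-- Shifted by one so that J 0 = 0, whose residue would spoil the sieve modulo 80, is left out.
J∘suc-recurrent : Recurrent 1 2 (J ∘ suc)
J∘suc-recurrent n = J-recurrent (suc n)

L-recurrent : Recurrent 1 1 L
L-recurrent n = cong₂ _+_ (sym (*-identityˡ (L (suc n)))) (sym (*-identityˡ (L n)))

module J₈₀ = Recurrence 1 2 80
module L₈₀ = Recurrence 1 1 80
module J₆₉₁₈₄ = Recurrence 1 2 69184
module L₆₉₁₈₄ = Recurrence 1 1 69184

J-period-80 : iterate J₈₀.step (J₈₀.state (J ∘ suc) 5) 4 ≡ J₈₀.state (J ∘ suc) 5
J-period-80 = refl

L-period-80 : iterate L₈₀.step (L₈₀.state L 0) 24 ≡ L₈₀.state L 0
L-period-80 = refl

J-period-69184 : iterate J₆₉₁₈₄.step (J₆₉₁₈₄.state J 6) 506 ≡ J₆₉₁₈₄.state J 6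
J-period-69184 = refl

L-period-69184 : iterate L₆₉₁₈₄.step (L₆₉₁₈₄.state L 0) 96 ≡ L₆₉₁₈₄.state L 0
L-period-69184 = refl

J-residues-80 : List ℕ
J-residues-80 = J₈₀.residues (J₈₀.state (J ∘ suc) 5) 4

L-residues-80 : List ℕ
L-residues-80 = L₈₀.residues (L₈₀.state L 0) 24

J-residues-69184 : List ℕ
J-residues-69184 = J₆₉₁₈₄.residues (J₆₉₁₈₄.state J 6) 506

L-residues-69184 : List ℕ
L-residues-69184 = L₆₉₁₈₄.residues (L₆₉₁₈₄.state L 0) 96

sums-avoid-80 : SumsAvoid 80 J-residues-80 (J₈₀.prefix (J ∘ suc) 5 ++ J-residues-80) L-residues-80
sums-avoid-80 = from-yes (sumsAvoid? 80 J-residues-80 (J₈₀.prefix (J ∘ suc) 5 ++ J-residues-80) L-residues-80)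

sums-avoid-69184 : SumsAvoid 69184 J-residues-69184 (J 0 % 69184 ∷ []) L-residues-69184
sums-avoid-69184 = from-yes (sumsAvoid? 69184 J-residues-69184 (J 0 % 69184 ∷ []) L-residues-69184)

sieve-80 : ∀ n m k → J (6 + n) + J (suc m) ≢ L k
sieve-80 n m k = sumsAvoid⇒+≢ 80 sums-avoid-80 {J (6 + n)} {J (suc m)}
  (J₈₀.∈-residues (J ∘ suc) J∘suc-recurrent 5 4 J-period-80 n)
  (J₈₀.∈-prefix++residues (J ∘ suc) J∘suc-recurrent 5 4 J-period-80 m)
  (L₈₀.∈-residues L L-recurrent 0 24 L-period-80 k)

sieve-69184 : ∀ n k → J (6 + n) + J 0 ≢ L k
sieve-69184 n k = sumsAvoid⇒+≢ 69184 sums-avoid-69184 {J (6 + n)} {J 0}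
  (J₆₉₁₈₄.∈-residues J J-recurrent 6 506 J-period-69184 n)
  (here refl)
  (L₆₉₁₈₄.∈-residues L L-recurrent 0 96 L-period-69184 k)

no-solution-beyond-5 : ∀ n m k → J (6 + n) + J m ≢ L k
no-solution-beyond-5 n zero    k = sieve-69184 n k
no-solution-beyond-5 n (suc m) k = sieve-80 n m k

L-positive : ∀ k → 1 ≤ L k
L-positive zero          = s≤s z≤n
L-positive (suc zero)    = s≤s z≤n
L-positive (suc (suc k)) = ≤-trans (L-positive (suc k)) (m≤m+n (L (suc k)) (L k))

n≤L[n] : ∀ k → k ≤ L k
n≤L[n] zero          = z≤n
n≤L[n] (suc zero)    = s≤s z≤n
n≤L[n] (suc (suc k)) = subst (_≤ L (2 + k)) (+-comm (suc k) 1) (+-mono-≤ (n≤L[n] (suc k)) (L-positive k))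

small-solutions : ∀ {n} → n < 6 → ∀ {m} → m < suc n → ∀ {k} → k < suc (J n + J m) →
                  J n + J m ≡ L k → (n , m , k) ∈ solutions
small-solutions = from-yes (allUpTo? (λ n → allUpTo? (λ m → allUpTo? (λ k →
                    (J n + J m ≟ L k) →-dec ((n , m , k) ∈ₜ? solutions)) (suc (J n + J m))) (suc n)) 6)
  where
  open import Data.List.Membership.DecPropositional (≡-dec _≟_ (≡-dec _≟_ _≟_))
    using () renaming (_∈?_ to _∈ₜ?_)

solutions-solve : All (λ { (n , m , k) → J n + J m ≡ L k }) solutions
solutions-solve = refl ∷ refl ∷ refl ∷ refl ∷ refl ∷ refl ∷ refl ∷ refl ∷ refl ∷ []

theorem1p1 : (n m k : ℕ) → m ≤ n → (J n + J m ≡ L k ⇔ (n , m , k) ∈ solutions)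
theorem1p1 n m k m≤n = mk⇔ solved⇒listed (lookup solutions-solve)
  where
  solved⇒listed : J n + J m ≡ L k → (n , m , k) ∈ solutions
  solved⇒listed eq with n <? 6
  ... | yes n<6 = small-solutions n<6 (s≤s m≤n) (s≤s (subst (k ≤_) (sym eq) (n≤L[n] k))) eq
  ... | no n≮6 with m≤n⇒∃[o]m+o≡n (≮⇒≥ n≮6)
  ...   | o , refl = contradiction eq (no-solution-beyond-5 o m k)
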